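{- Let $n\ge 1$ and $t\ge 0$ be integers, and let $C$ be a configuration of $t$ pebbles on the vertices of the complete graph $K_n$. Let $X$ denote the number of vertices $v$ of $K_n$ for which $C(v)$ is odd. Then $C$ is cover solvable if and only if $X+t\ge 2n$.
   Context: A configuration of weight $t$ on a graph $G$ is a function $C:V(G)\to\mathbb{N}\cup\{0\}$ with $\sum_{v\in V(G)}C(v)=t$ (the number of pebbles on each vertex). A pebbling move consists of removing two pebbles from some vertex and placing one pebble on an adjacent vertex (the other pebble is discarded). A configuration is cover solvable if some finite sequence of pebbling moves (each move performed only from a vertex currently holding at least two pebbles) results in a configuration with at least one pebble on every vertex of $G$ simultaneously. -}

module Defs where

open import Data.Nat using (ℕ; zero; suc; _+_; _*_; _≤_)
open import Data.Fin using (Fin)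
open import Data.Vec.Functional using (Vector; updateAt)
open import Data.Nat.Base using (_%_)
open import Relation.Binary.PropositionalEquality using (_≡_; _≢_)
open import Relation.Binary.Construct.Closure.ReflexiveTransitive using (Star)
open import Data.Product using (_×_; ∃-syntax)

sumFin : ∀ {n} → (Fin n → ℕ) → ℕ
sumFin {zero}  f = 0
sumFin {suc n} f = f Fin.zero + sumFin {n} (λ i → f (Fin.suc i))

Config : ℕ → Set
Config n = Fin n → ℕ

weight : ∀ {n} → Config n → ℕ
weight = sumFin

oddCount : ∀ {n} → Config n → ℕ
oddCount C = sumFin (λ v → C v % 2)

-- One pebbling move on K_n: from u (holding ≥ 2 pebbles) to an adjacent
-- vertex w (in K_n, any w ≢ u): C' = C - 2 at u, + 1 at w.
data Move {n : ℕ} (C : Config n) : Config n → Set where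
  move : (u w : Fin n) → u ≢ w → (c : ℕ) → C u ≡ 2 + c →
         Move C (updateAt (updateAt C u (λ _ → c)) w suc)

Reachable : ∀ {n} → Config n → Config n → Set
Reachable = Star Move

Covered : ∀ {n} → Config n → Set
Covered C = ∀ v → 1 ≤ C v

CoverSolvable : ∀ {n} → Config n → Set
CoverSolvable C = ∃[ D ] (Reachable C D × Covered D)

-- Round every pile up to an even number: the rounded total, evenWeight C, is
-- t + X. A move never increases it (the source loses exactly 2, the target
-- gains at most 2), and a covered configuration has evenWeight at least 2n.
-- Conversely, while some vertex is empty and evenWeight C ≥ 2n, some vertex
-- holds at least two pebbles (otherwise evenWeight C ≤ 2(n - 1)); moving from
-- it to the empty vertex keeps evenWeight and lowers the weight, so repeating
-- this ends in a covered configuration.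
module Submission where

open import Defs
open import Data.Nat using (ℕ; zero; suc; _+_; _*_; _≤_; _<_; _∸_; _%_; z≤n; s≤s; _≟_; _≤?_)
open import Data.Nat.Properties
open import Data.Nat.DivMod using ([m+n]%n≡m%n; m%n<n)
open import Data.Fin using (Fin; punchIn)
open import Data.Fin.Properties using (any?; punchInᵢ≢i)
open import Data.Vec.Functional using (updateAt; removeAt)
open import Data.Vec.Functional.Properties using (updateAt-updates; updateAt-minimal)
open import Data.Product using (_×_; _,_; ∃-syntax)
open import Data.Sum using (_⊎_; inj₁; inj₂)
open import Data.Empty using (⊥-elim)
open import Function using (id; _∘_)
open import Relation.Nullary using (yes; no)
open import Relation.Binary.PropositionalEquality
open import Relation.Binary.Construct.Closure.ReflexiveTransitive using (ε; _◅_)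
open import Algebra.Properties.CommutativeMonoid.Sum +-0-commutativeMonoid
  using (sum; sum-cong-≗; sum-remove; ∑-distrib-+)
open import Algebra.Properties.CommutativeSemigroup +-commutativeSemigroup
  using (xy∙z≈zy∙x; xy∙z≈xz∙y; x∙yz≈y∙xz; x∙yz≈xz∙y)

sumFin≡sum : ∀ {n} (f : Fin n → ℕ) → sumFin f ≡ sum f
sumFin≡sum {zero}  f = refl
sumFin≡sum {suc n} f = cong (f Fin.zero +_) (sumFin≡sum (f ∘ Fin.suc))

sumFin-+ : ∀ {n} (f g : Fin n → ℕ) → sumFin (λ v → f v + g v) ≡ sumFin f + sumFin g
sumFin-+ f g = begin
  sumFin (λ v → f v + g v) ≡⟨ sumFin≡sum (λ v → f v + g v) ⟩
  sum (λ v → f v + g v)    ≡⟨ ∑-distrib-+ f g ⟩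
  sum f + sum g            ≡⟨ sym (cong₂ _+_ (sumFin≡sum f) (sumFin≡sum g)) ⟩
  sumFin f + sumFin g      ∎
  where open ≡-Reasoning

sumFin-removeAt : ∀ {n} (f : Fin (suc n) → ℕ) u → sumFin f ≡ f u + sumFin (removeAt f u)
sumFin-removeAt f u = begin
  sumFin f                     ≡⟨ sumFin≡sum f ⟩
  sum f                        ≡⟨ sum-remove f ⟩
  f u + sum (removeAt f u)     ≡⟨ cong (f u +_) (sym (sumFin≡sum (removeAt f u))) ⟩
  f u + sumFin (removeAt f u)  ∎
  where open ≡-Reasoning

sumFin-exchange : ∀ {n} (f g : Fin n → ℕ) u → (∀ v → v ≢ u → g v ≡ f v) →
  sumFin g + f u ≡ sumFin f + g u
sumFin-exchange {suc n} f g u agree = begin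
  sumFin g + f u                        ≡⟨ cong (_+ f u) (sumFin-removeAt g u) ⟩
  g u + sumFin (removeAt g u) + f u     ≡⟨ cong (λ s → g u + s + f u) rest ⟩
  g u + sumFin (removeAt f u) + f u     ≡⟨ xy∙z≈zy∙x (g u) _ (f u) ⟩
  f u + sumFin (removeAt f u) + g u     ≡⟨ cong (_+ g u) (sym (sumFin-removeAt f u)) ⟩
  sumFin f + g u                        ∎
  where
  open ≡-Reasoning
  rest : sumFin (removeAt g u) ≡ sumFin (removeAt f u)
  rest = trans (sumFin≡sum (removeAt g u))
           (trans (sum-cong-≗ (λ v → agree _ (punchInᵢ≢i u v))) (sym (sumFin≡sum (removeAt f u))))

sumFin-bounded-below : ∀ {n} k (f : Fin n → ℕ) → (∀ v → k ≤ f v) → n * k ≤ sumFin f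
sumFin-bounded-below {zero}  k f k≤f = z≤n
sumFin-bounded-below {suc n} k f k≤f =
  +-mono-≤ (k≤f Fin.zero) (sumFin-bounded-below k (f ∘ Fin.suc) (k≤f ∘ Fin.suc))

sumFin-bounded-above : ∀ {n} k (f : Fin n → ℕ) → (∀ v → f v ≤ k) → sumFin f ≤ n * k
sumFin-bounded-above {zero}  k f f≤k = z≤n
sumFin-bounded-above {suc n} k f f≤k =
  +-mono-≤ (f≤k Fin.zero) (sumFin-bounded-above k (f ∘ Fin.suc) (f≤k ∘ Fin.suc))

sumFin-bounded-above-with-zero : ∀ {n} k (f : Fin n → ℕ) z → f z ≡ 0 → (∀ v → f v ≤ k) →
  sumFin f + k ≤ n * k
sumFin-bounded-above-with-zero {suc n} k f z fz≡0 f≤k = begin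
  sumFin f + k                      ≡⟨ cong (_+ k) (sumFin-removeAt f z) ⟩
  f z + sumFin (removeAt f z) + k   ≡⟨ cong (λ x → x + sumFin (removeAt f z) + k) fz≡0 ⟩
  sumFin (removeAt f z) + k         ≤⟨ +-monoˡ-≤ k (sumFin-bounded-above k _ (f≤k ∘ punchIn z)) ⟩
  n * k + k                         ≡⟨ +-comm (n * k) k ⟩
  suc n * k                         ∎
  where open ≤-Reasoning

evenUp : ℕ → ℕ
evenUp c = c + c % 2

evenUp-2+ : ∀ c → evenUp (2 + c) ≡ 2 + evenUp c
evenUp-2+ c = cong (2 + c +_) (trans (cong (_% 2) (+-comm 2 c)) ([m+n]%n≡m%n c 2))

evenUp-suc-≤ : ∀ c → evenUp (suc c) ≤ 2 + evenUp c
evenUp-suc-≤ c = begin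
  suc c + suc c % 2  ≤⟨ +-monoʳ-≤ (suc c) (≤-pred (m%n<n (suc c) 2)) ⟩
  suc c + 1          ≡⟨ +-comm (suc c) 1 ⟩
  2 + c              ≤⟨ m≤m+n (2 + c) (c % 2) ⟩
  2 + evenUp c       ∎
  where open ≤-Reasoning

evenUp-≥2 : ∀ c → 1 ≤ c → 2 ≤ evenUp c
evenUp-≥2 (suc zero)    _ = ≤-refl
evenUp-≥2 (suc (suc c)) _ = s≤s (s≤s z≤n)

evenUp-≤2 : ∀ c → c < 2 → evenUp c ≤ 2
evenUp-≤2 zero          _                = z≤n
evenUp-≤2 (suc zero)    _                = ≤-refl
evenUp-≤2 (suc (suc c)) (s≤s (s≤s ()))

evenWeight : ∀ {n} → Config n → ℕ
evenWeight C = sumFin (evenUp ∘ C)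

evenWeight≡weight+oddCount : ∀ {n} (C : Config n) → evenWeight C ≡ weight C + oddCount C
evenWeight≡weight+oddCount C = sumFin-+ C (λ v → C v % 2)

afterMove : ∀ {n} → Config n → Fin n → Fin n → ℕ → Config n
afterMove C u w c = updateAt (updateAt C u (λ _ → c)) w suc

sumFin-afterMove : ∀ {n} (h : ℕ → ℕ) {C : Config n} {u w : Fin n} {c : ℕ} → u ≢ w → C u ≡ 2 + c →
  sumFin (h ∘ afterMove C u w c) + (h (2 + c) + h (C w)) ≡ sumFin (h ∘ C) + (h c + h (suc (C w)))
sumFin-afterMove h {C} {u} {w} {c} u≢w Cu = begin
  S D + (h (2 + c) + h (C w))     ≡⟨ cong₂ (λ x y → S D + (h x + h y)) (sym Cu) (sym C₁w≡Cw) ⟩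
  S D + (h (C u) + h (C₁ w))      ≡⟨ x∙yz≈xz∙y (S D) (h (C u)) _ ⟩
  S D + h (C₁ w) + h (C u)        ≡⟨ cong (_+ h (C u)) atTarget ⟩
  S C₁ + h (suc (C₁ w)) + h (C u) ≡⟨ xy∙z≈xz∙y (S C₁) _ (h (C u)) ⟩
  S C₁ + h (C u) + h (suc (C₁ w)) ≡⟨ cong₂ _+_ atSource (cong (h ∘ suc) C₁w≡Cw) ⟩
  S C + h c + h (suc (C w))       ≡⟨ +-assoc (S C) (h c) _ ⟩
  S C + (h c + h (suc (C w)))     ∎
  where
  open ≡-Reasoning
  S : Config _ → ℕ
  S E = sumFin (h ∘ E)
  C₁ = updateAt C u (λ _ → c)
  D = afterMove C u w c
  C₁w≡Cw : C₁ w ≡ C w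
  C₁w≡Cw = updateAt-minimal w u C (u≢w ∘ sym)
  atSource : S C₁ + h (C u) ≡ S C + h c
  atSource = trans (sumFin-exchange (h ∘ C) (h ∘ C₁) u (λ v v≢u → cong h (updateAt-minimal v u C v≢u)))
                   (cong (λ x → S C + h x) (updateAt-updates u C))
  atTarget : S D + h (C₁ w) ≡ S C₁ + h (suc (C₁ w))
  atTarget = trans (sumFin-exchange (h ∘ C₁) (h ∘ D) w (λ v v≢w → cong h (updateAt-minimal v w C₁ v≢w)))
                   (cong (λ x → S C₁ + h x) (updateAt-updates w C₁))

weight-move : ∀ {n} {C D : Config n} → Move C D → suc (weight D) ≡ weight C
weight-move {C = C} (move u w u≢w c Cu) = +-cancelʳ-≡ (c + suc (C w)) _ _ (begin
  suc (weight D) + (c + suc (C w)) ≡⟨ cong (λ x → suc (weight D + x)) (+-suc c (C w)) ⟩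
  suc (weight D + suc (c + C w))   ≡⟨ sym (+-suc (weight D) _) ⟩
  weight D + (2 + c + C w)         ≡⟨ sumFin-afterMove id u≢w Cu ⟩
  weight C + (c + suc (C w))       ∎)
  where
  open ≡-Reasoning
  D = afterMove C u w c

evenUp-transfer-≤ : ∀ c x → evenUp c + evenUp (suc x) ≤ evenUp (2 + c) + evenUp x
evenUp-transfer-≤ c x = begin
  evenUp c + evenUp (suc x)   ≤⟨ +-monoʳ-≤ (evenUp c) (evenUp-suc-≤ x) ⟩
  evenUp c + (2 + evenUp x)   ≡⟨ x∙yz≈y∙xz (evenUp c) 2 (evenUp x) ⟩
  2 + evenUp c + evenUp x     ≡⟨ cong (_+ evenUp x) (sym (evenUp-2+ c)) ⟩
  evenUp (2 + c) + evenUp x   ∎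
  where open ≤-Reasoning

evenUp-transfer-to-empty : ∀ c → evenUp c + evenUp 1 ≡ evenUp (2 + c) + evenUp 0
evenUp-transfer-to-empty c = begin
  evenUp c + 2        ≡⟨ +-comm (evenUp c) 2 ⟩
  2 + evenUp c        ≡⟨ sym (evenUp-2+ c) ⟩
  evenUp (2 + c)      ≡⟨ sym (+-identityʳ _) ⟩
  evenUp (2 + c) + 0  ∎
  where open ≡-Reasoning

evenWeight-move : ∀ {n} {C D : Config n} → Move C D → evenWeight D ≤ evenWeight C
evenWeight-move {C = C} (move u w u≢w c Cu) = +-cancelʳ-≤ (evenUp (2 + c) + evenUp (C w)) _ _ (begin
  evenWeight (afterMove C u w c) + (evenUp (2 + c) + evenUp (C w)) ≡⟨ sumFin-afterMove evenUp u≢w Cu ⟩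
  evenWeight C + (evenUp c + evenUp (suc (C w)))                   ≤⟨ +-monoʳ-≤ _ (evenUp-transfer-≤ c (C w)) ⟩
  evenWeight C + (evenUp (2 + c) + evenUp (C w))                   ∎)
  where open ≤-Reasoning

evenWeight-reachable : ∀ {n} {C D : Config n} → Reachable C D → evenWeight D ≤ evenWeight C
evenWeight-reachable ε          = ≤-refl
evenWeight-reachable (m ◅ rest) = ≤-trans (evenWeight-reachable rest) (evenWeight-move m)

evenWeight-covered : ∀ {n} (C : Config n) → Covered C → 2 * n ≤ evenWeight C
evenWeight-covered {n} C cov =
  subst (_≤ evenWeight C) (*-comm n 2) (sumFin-bounded-below 2 (evenUp ∘ C) (λ v → evenUp-≥2 (C v) (cov v)))

evenWeight-afterMove-to-empty : ∀ {n} {C : Config n} {u w : Fin n} {c : ℕ} →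
  u ≢ w → C u ≡ 2 + c → C w ≡ 0 → evenWeight (afterMove C u w c) ≡ evenWeight C
evenWeight-afterMove-to-empty {C = C} {w = w} {c} u≢w Cu Cw≡0 =
  +-cancelʳ-≡ (evenUp (2 + c) + evenUp (C w)) _ _
    (trans (sumFin-afterMove evenUp u≢w Cu) (cong (evenWeight C +_) transfer))
  where
  transfer : evenUp c + evenUp (suc (C w)) ≡ evenUp (2 + c) + evenUp (C w)
  transfer = subst (λ x → evenUp c + evenUp (suc x) ≡ evenUp (2 + c) + evenUp x)
                   (sym Cw≡0) (evenUp-transfer-to-empty c)

covered-or-empty : ∀ {n} (C : Config n) → Covered C ⊎ ∃[ z ] C z ≡ 0
covered-or-empty C with any? (λ z → C z ≟ 0)
... | yes empty    = inj₂ empty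
... | no noneEmpty = inj₁ (λ v → n≢0⇒n>0 (λ Cv≡0 → noneEmpty (v , Cv≡0)))

movable-vertex : ∀ {n} (C : Config n) z → C z ≡ 0 → 2 * n ≤ evenWeight C → ∃[ u ] ∃[ c ] C u ≡ 2 + c
movable-vertex {n} C z Cz≡0 2n≤ with any? (λ u → 2 ≤? C u)
... | yes (u , 2≤Cu) = u , C u ∸ 2 , sym (m+[n∸m]≡n 2≤Cu)
... | no noneMovable  = ⊥-elim (m+1+n≰m (evenWeight C) (begin
  evenWeight C + 2 ≤⟨ sumFin-bounded-above-with-zero 2 (evenUp ∘ C) z (cong evenUp Cz≡0) small ⟩
  n * 2            ≡⟨ *-comm n 2 ⟩
  2 * n            ≤⟨ 2n≤ ⟩
  evenWeight C     ∎))
  where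
  open ≤-Reasoning
  small : ∀ v → evenUp (C v) ≤ 2
  small v = evenUp-≤2 (C v) (≰⇒> (λ 2≤Cv → noneMovable (v , 2≤Cv)))

cover-solvable : ∀ {n} t (C : Config n) → weight C ≡ t → 2 * n ≤ evenWeight C → CoverSolvable C
cover-solvable {n} t C wC≡t 2n≤ with covered-or-empty C
... | inj₁ cov = C , ε , cov
... | inj₂ (z , Cz≡0) with movable-vertex C z Cz≡0 2n≤
... | u , c , Cu = continue t wC≡t
  where
  u≢z : u ≢ z
  u≢z refl = 0≢1+n (trans (sym Cz≡0) Cu)
  step : Move C (afterMove C u z c)
  step = move u z u≢z c Cu
  continue : ∀ t → weight C ≡ t → CoverSolvable C
  continue zero    wC≡0 = ⊥-elim (1+n≢0 (trans (weight-move step) wC≡0))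
  continue (suc t) wC≡1+t with cover-solvable t (afterMove C u z c)
      (suc-injective (trans (weight-move step) wC≡1+t))
      (subst (2 * n ≤_) (sym (evenWeight-afterMove-to-empty u≢z Cu Cz≡0)) 2n≤)
  ... | E , reach , cov = E , step ◅ reach , cov

lemma1 : (n t : ℕ) → 1 ≤ n → (C : Config n) → weight C ≡ t →
    (CoverSolvable C → 2 * n ≤ oddCount C + t) × (2 * n ≤ oddCount C + t → CoverSolvable C)
lemma1 n t _ C wC≡t = necessary , sufficient
  where
  evenWeight≡oddCount+t : evenWeight C ≡ oddCount C + t
  evenWeight≡oddCount+t = trans (evenWeight≡weight+oddCount C)
    (trans (+-comm (weight C) (oddCount C)) (cong (oddCount C +_) wC≡t))
  necessary : CoverSolvable C → 2 * n ≤ oddCount C + t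
  necessary (D , reach , cov) =
    subst (2 * n ≤_) evenWeight≡oddCount+t (≤-trans (evenWeight-covered D cov) (evenWeight-reachable reach))
  sufficient : 2 * n ≤ oddCount C + t → CoverSolvable C
  sufficient 2n≤ = cover-solvable t C wC≡t (subst (2 * n ≤_) (sym evenWeight≡oddCount+t) 2n≤)
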